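{- The following problem is decidable: given a $\beta$-normal $\lambda$-term $t$, a context $\Gamma$ and a type $A$, determine whether $\Gamma\vdash_{\mathcal F_0}t:A$.
   Context: Types of System $\mathcal F$ are built from type variables (and type constants) with $\rightarrow$ and $\forall$. A context is $\Gamma=x_1:A_1,\dots,x_n:A_n$. The system $\mathcal F_0$ derives judgements $\Gamma\vdash_{\mathcal F_0}t:A$ for pure $\lambda$-terms by the rules: (ax) $\Gamma\vdash x_i:A_i$; ($\rightarrow_i$) from $\Gamma,x:B\vdash t:C$ infer $\Gamma\vdash\lambda xt:B\rightarrow C$; ($\rightarrow_e$) from $\Gamma\vdash u:B\rightarrow C$ and $\Gamma\vdash v:B$ infer $\Gamma\vdash(u)v:C$; ($\forall_i$) from $\Gamma\vdash t:A$ with $X$ not free in $\Gamma$ infer $\Gamma\vdash t:\forall XA$ (there is no $\forall$-elimination rule). -}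

module Defs where

open import Data.Nat using (ℕ; zero; suc; _<ᵇ_)
open import Data.Bool using (if_then_else_)
open import Data.Fin using (Fin)
open import Data.Vec using (Vec; lookup; map; _∷_)
open import Relation.Nullary using (¬_)

-- Types of System F: type variables (de Bruijn indices), type constants,
-- arrow, and ∀ (binding de Bruijn index 0).
data Ty : Set where
  tvar   : ℕ → Ty
  tconst : ℕ → Ty
  _⇒_    : Ty → Ty → Ty
  ∀'     : Ty → Ty

infixr 7 _⇒_

shiftFrom : ℕ → Ty → Ty
shiftFrom c (tvar n)   = if n <ᵇ c then tvar n else tvar (suc n)
shiftFrom c (tconst k) = tconst k
shiftFrom c (A ⇒ B)    = shiftFrom c A ⇒ shiftFrom c B
shiftFrom c (∀' A)     = ∀' (shiftFrom (suc c) A)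

↑ : Ty → Ty
↑ = shiftFrom 0

data Term (n : ℕ) : Set where
  var : Fin n → Term n
  lam : Term (suc n) → Term n
  app : Term n → Term n → Term n

data HasRedex {n : ℕ} : Term n → Set where
  here  : (u : Term (suc n)) (v : Term n) → HasRedex (app (lam u) v)
  lam   : {t : Term (suc n)} → HasRedex t → HasRedex (lam t)
  appˡ  : {u : Term n} (v : Term n) → HasRedex u → HasRedex (app u v)
  appʳ  : (u : Term n) {v : Term n} → HasRedex v → HasRedex (app u v)

BetaNormal : {n : ℕ} → Term n → Set
BetaNormal t = ¬ HasRedex t

Ctx : ℕ → Set
Ctx n = Vec Ty n

-- The system F₀ (no ∀-elimination).  The ∀-introduction rule
-- "Γ ⊢ t : A, X not free in Γ ⟹ Γ ⊢ t : ∀X A" is rendered in de Bruijn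
-- style: the bound variable is index 0 and the context is shifted.
data _⊢_∶_ {n : ℕ} (Γ : Ctx n) : Term n → Ty → Set where
  ax   : (i : Fin n) → Γ ⊢ var i ∶ lookup Γ i
  →i   : {t : Term (suc n)} {B C : Ty} → (B ∷ Γ) ⊢ t ∶ C → Γ ⊢ lam t ∶ (B ⇒ C)
  →e   : {u v : Term n} {B C : Ty} → Γ ⊢ u ∶ (B ⇒ C) → Γ ⊢ v ∶ B → Γ ⊢ app u v ∶ C
  ∀i   : {t : Term n} {A : Ty} → map ↑ Γ ⊢ t ∶ A → Γ ⊢ t ∶ ∀' A

module Submission where

-- Every derivation ends in one of two ways: by the rule for the shape of the
-- term (axiom, →-introduction, →-elimination), or by ∀-introduction.  So
-- "Γ ⊢ t ∶ A" is equivalent to "Direct Γ t A ⊎ Generalised Γ t A", where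
-- Generalised is "Γ↑ ⊢ t ∶ A′" when A = ∀A′ (impossible otherwise).
--
-- The only non-syntax-directed case is an application u v: the argument type
-- B in "Γ ⊢ u ∶ B ⇒ A, Γ ⊢ v ∶ B" is not visible in the goal.  Because t is
-- β-normal, the head u is neutral (a variable applied to arguments), and a
-- neutral term has at most one arrow type, namely the type read off from the
-- context along its spine (synth).  Hence B is the domain of synth Γ u, and
-- deciding the application amounts to checking this single candidate.

open import Defs
open import Data.Nat as ℕ using (ℕ)
open import Data.Fin using (Fin)
open import Data.Vec using (lookup; map; _∷_)
open import Data.Maybe using (Maybe; just; nothing; _>>=_)
open import Data.Maybe.Properties using (just-injective)
open import Data.Product using (Σ-syntax; _×_; _,_)
open import Data.Sum using (_⊎_; inj₁; inj₂; [_,_])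
open import Data.Empty using (⊥)
open import Function using (case_of_)
open import Relation.Nullary using (Dec; yes; no)
open import Relation.Nullary.Decidable using (map′; _×-dec_; _⊎-dec_)
open import Relation.Binary.Definitions using (DecidableEquality)
open import Relation.Binary.PropositionalEquality
  using (_≡_; refl; cong; cong₂; trans; sym; subst)

private
  variable
    n : ℕ
    Γ : Ctx n
    A B C : Ty
    t u v : Term n

_≟_ : DecidableEquality Ty
tvar a   ≟ tvar b   = map′ (cong tvar) (λ { refl → refl }) (a ℕ.≟ b)
tconst a ≟ tconst b = map′ (cong tconst) (λ { refl → refl }) (a ℕ.≟ b)
(A ⇒ B)  ≟ (C ⇒ D)  =
  map′ (λ (p , q) → cong₂ _⇒_ p q) (λ { refl → refl , refl }) (A ≟ C ×-dec B ≟ D)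
∀' A     ≟ ∀' B     = map′ (cong ∀') (λ { refl → refl }) (A ≟ B)
tvar _   ≟ tconst _ = no λ ()
tvar _   ≟ (_ ⇒ _)  = no λ ()
tvar _   ≟ ∀' _     = no λ ()
tconst _ ≟ tvar _   = no λ ()
tconst _ ≟ (_ ⇒ _)  = no λ ()
tconst _ ≟ ∀' _     = no λ ()
(_ ⇒ _)  ≟ tvar _   = no λ ()
(_ ⇒ _)  ≟ tconst _ = no λ ()
(_ ⇒ _)  ≟ ∀' _     = no λ ()
∀' _     ≟ tvar _   = no λ ()
∀' _     ≟ tconst _ = no λ ()
∀' _     ≟ (_ ⇒ _)  = no λ ()

data Neutral {n : ℕ} : Term n → Set where
  var : (i : Fin n) → Neutral (var i)
  app : (v : Term n) → Neutral u → Neutral (app u v)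

normal-body : BetaNormal (lam t) → BetaNormal t
normal-body nf r = nf (lam r)

normal-fun : BetaNormal (app u v) → BetaNormal u
normal-fun {v = v} nf r = nf (appˡ v r)

normal-arg : BetaNormal (app u v) → BetaNormal v
normal-arg {u = u} nf r = nf (appʳ u r)

normal-head-neutral : BetaNormal (app u v) → Neutral u
normal-head-neutral {u = var i}     nf = var i
normal-head-neutral {u = lam b} {v} nf = case nf (here b v) of λ ()
normal-head-neutral {u = app u w}   nf = app w (normal-head-neutral (normal-fun nf))

codomain : Ty → Maybe Ty
codomain (_ ⇒ C) = just C
codomain _       = nothing

domain : Ty → Maybe Ty
domain (B ⇒ _) = just B
domain _       = nothing

synth : Ctx n → Term n → Maybe Ty
synth Γ (var i)   = just (lookup Γ i)
synth Γ (lam _)   = nothing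
synth Γ (app u _) = synth Γ u >>= codomain

Direct : Ctx n → Term n → Ty → Set
Direct Γ (var i)   A       = lookup Γ i ≡ A
Direct Γ (lam b)   (B ⇒ C) = (B ∷ Γ) ⊢ b ∶ C
Direct Γ (lam b)   _       = ⊥
Direct Γ (app u v) A       = Σ[ B ∈ Ty ] (Γ ⊢ u ∶ (B ⇒ A) × Γ ⊢ v ∶ B)

Generalised : Ctx n → Term n → Ty → Set
Generalised Γ t (∀' A) = map ↑ Γ ⊢ t ∶ A
Generalised Γ t _      = ⊥

last-rule : Γ ⊢ t ∶ A → Direct Γ t A ⊎ Generalised Γ t A
last-rule (ax i)     = inj₁ refl
last-rule (→i d)     = inj₁ d
last-rule (→e du dv) = inj₁ (_ , du , dv)
last-rule (∀i d)     = inj₂ d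

from-direct : Direct Γ t A → Γ ⊢ t ∶ A
from-direct {t = var i}   refl           = ax i
from-direct {t = lam b}   {A = _ ⇒ _} d  = →i d
from-direct {t = app u v} (_ , du , dv)  = →e du dv

from-generalised : Generalised Γ t A → Γ ⊢ t ∶ A
from-generalised {A = ∀' A} d = ∀i d

mutual
  synth-direct : Neutral t → Direct Γ t A → synth Γ t ≡ just A
  synth-direct (var i)   refl         = refl
  synth-direct (app v u) (_ , du , _) rewrite synth-arrow u du = refl

  -- Uniqueness of arrow types: any arrow type derivable for a neutral term is
  -- its synthesised type, since ∀-introduction never concludes an arrow type
  -- and there is no ∀-elimination to turn a ∀-type back into an arrow.
  synth-arrow : Neutral t → Γ ⊢ t ∶ (B ⇒ C) → synth Γ t ≡ just (B ⇒ C)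
  synth-arrow ne d with last-rule d
  ... | inj₁ direct = synth-direct ne direct

domain-unique : Neutral u → Γ ⊢ u ∶ (B ⇒ C) → (synth Γ u >>= domain) ≡ just B
domain-unique u du rewrite synth-arrow u du = refl

mutual
  check : (Γ : Ctx n) (t : Term n) (A : Ty) → BetaNormal t → Dec (Γ ⊢ t ∶ A)
  check Γ t A nf =
    map′ [ from-direct , from-generalised ] last-rule
         (decDirect Γ t A nf ⊎-dec decGeneralised Γ t A nf)

  decGeneralised : (Γ : Ctx n) (t : Term n) (A : Ty) → BetaNormal t →
    Dec (Generalised Γ t A)
  decGeneralised Γ t (∀' A)     nf = check (map ↑ Γ) t A nf
  decGeneralised Γ t (tvar _)   nf = no λ ()
  decGeneralised Γ t (tconst _) nf = no λ ()
  decGeneralised Γ t (_ ⇒ _)    nf = no λ ()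

  decDirect : (Γ : Ctx n) (t : Term n) (A : Ty) → BetaNormal t →
    Dec (Direct Γ t A)
  decDirect Γ (var i)   A          nf = lookup Γ i ≟ A
  decDirect Γ (lam b)   (B ⇒ C)    nf = check (B ∷ Γ) b C (normal-body nf)
  decDirect Γ (lam b)   (tvar _)   nf = no λ ()
  decDirect Γ (lam b)   (tconst _) nf = no λ ()
  decDirect Γ (lam b)   (∀' _)     nf = no λ ()
  decDirect Γ (app u v) A          nf =
    decApply Γ u v A (normal-head-neutral nf) (normal-fun nf) (normal-arg nf)

  decApply : (Γ : Ctx n) (u v : Term n) (A : Ty) →
    Neutral u → BetaNormal u → BetaNormal v →
    Dec (Σ[ B ∈ Ty ] (Γ ⊢ u ∶ (B ⇒ A) × Γ ⊢ v ∶ B))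
  decApply Γ u v A ne nfu nfv with synth Γ u >>= domain in candidate
  ... | nothing = no λ (_ , du , _) →
    case trans (sym candidate) (domain-unique ne du) of λ ()
  ... | just B = map′ (λ (du , dv) → B , du , dv) only-candidate
                      (check Γ u (B ⇒ A) nfu ×-dec check Γ v B nfv)
    where
    only-candidate : Σ[ B′ ∈ Ty ] (Γ ⊢ u ∶ (B′ ⇒ A) × Γ ⊢ v ∶ B′) →
      Γ ⊢ u ∶ (B ⇒ A) × Γ ⊢ v ∶ B
    only-candidate (B′ , du , dv) =
      subst (λ X → Γ ⊢ u ∶ (X ⇒ A) × Γ ⊢ v ∶ X)
            (just-injective (trans (sym (domain-unique ne du)) candidate))
            (du , dv)

theorem2p2p1 : {n : ℕ} (Γ : Ctx n) (t : Term n) (A : Ty) →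
    BetaNormal t → Dec (Γ ⊢ t ∶ A)
theorem2p2p1 = check
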